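{- For every integer $n\ge 2$, \[ N_M(n) := \max_{\pi,\rho\in\Pi(n),\ \pi\ne\rho} |S^{M}_{\mathrm{out}}(\pi)\cap S^{M}_{\mathrm{out}}(\rho)| = 2^{n-1}. \]
   Context: $\Pi(n)$ denotes the set of permutations of $\{1,\dots,n\}$, each regarded as a sequence $\pi=(\pi_1,\dots,\pi_n)$. A mirror TDRL (MTDRL) operation on $\pi$ is specified by a binary pattern $b\in\{0,1\}^n$. Its result is the concatenation of $(\pi_i:b_i=1)$, with indices in increasing order, followed by $(\pi_i:b_i=0)$, with indices in decreasing order. $S^{M}_{\mathrm{out}}(\pi)$ is the set of all sequences obtainable from $\pi$ by one MTDRL operation. -}

module Defs where

open import Data.Nat using (ℕ; zero; suc; _≤_; _^_; _∸_)
open import Data.Bool using (Bool; true; false)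
open import Data.List using (List; []; _∷_; _++_; reverse; length; filter; deduplicate; concatMap; map; applyUpTo)
import Data.List.Properties as LP
open import Data.List.Membership.DecPropositional using () renaming (_∈?_ to mem?)
open import Data.List.Relation.Binary.Permutation.Propositional using (_↭_)
open import Data.Nat.Properties using () renaming (_≟_ to _≟ℕ_)

Seq : Set
Seq = List ℕ

oneTo : ℕ → List ℕ
oneTo n = applyUpTo suc n

IsPerm : ℕ → Seq → Set
IsPerm n π = π ↭ oneTo n

pick : Seq → List Bool → Seq
pick (x ∷ xs) (true  ∷ bs) = x ∷ pick xs bs
pick (x ∷ xs) (false ∷ bs) = pick xs bs
pick _        _            = []

pickNot : Seq → List Bool → Seq
pickNot (x ∷ xs) (false ∷ bs) = x ∷ pickNot xs bs
pickNot (x ∷ xs) (true  ∷ bs) = pickNot xs bs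
pickNot _        _            = []

mtdrl : Seq → List Bool → Seq
mtdrl π b = pick π b ++ reverse (pickNot π b)

patterns : ℕ → List (List Bool)
patterns zero    = [] ∷ []
patterns (suc n) = concatMap (λ b → (true ∷ b) ∷ (false ∷ b) ∷ []) (patterns n)

-- S^M_out(π) as a list (possibly with repetitions) of all MTDRL results.
SoutList : Seq → List Seq
SoutList π = map (mtdrl π) (patterns (length π))

seq≟ : (x y : Seq) → _
seq≟ = LP.≡-dec _≟ℕ_

interSize : Seq → Seq → ℕ
interSize π ρ =
  length (deduplicate seq≟ (filter (λ σ → mem? seq≟ σ (SoutList ρ)) (SoutList π)))

-- Upper bound.  Write π = xs ∷ʳ a.  Whatever the last bit of the pattern is,
-- the last entry a lands between the increasing and the decreasing half, so
-- every result of π is determined by the bits of xs alone: S_out(π) is covered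
-- by a list of 2^(n-1) sequences.  The intersection, as a duplicate-free
-- list contained in S_out(π), is therefore no longer than that list.
--
-- Lower bound.  Prepending a new first entry x to π sends x either to the front
-- (bit 1) or to the end (bit 0) of each result.  Hence a family L of common
-- results of π and ρ yields the family x∷L ++ L∷ʳx of common results of x∷π and
-- x∷ρ, of twice the size when no member of L starts with x.  Starting from
-- (1,2) and (2,1) and prepending 3, 4, ..., n gives 2^(n-1) common results of
-- (n, ..., 3, 1, 2) and (n, ..., 3, 2, 1).
module Submission where

open import Defs
open import Data.Nat using (ℕ; _≤_; _^_; _∸_)
open import Data.Product using (Σ; _×_)
open import Data.List using (List)
open import Relation.Binary.PropositionalEquality using (_≡_; _≢_)

open import Data.Nat using (zero; suc; _+_; _*_; _<_; z≤n; s≤s)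
open import Data.Nat.Properties
  using (≤-trans; ≤-reflexive; ≤-antisym; <⇒≤; <-≤-trans; <-irrefl; n<1+n; +-comm; +-identityʳ; *-suc; suc-injective)
open import Data.Bool using (Bool; true; false)
open import Data.Empty using (⊥; ⊥-elim)
open import Data.Product using (_,_; proj₁; proj₂; ∃)
open import Data.List using ([]; _∷_; _++_; _∷ʳ_; [_]; reverse; length; map; concatMap; filter; deduplicate; initLast; _∷ʳ′_)
open import Data.List.Properties
  using (length-++; length-map; ++-assoc; ++-identityʳ; reverse-++; unfold-reverse; ∷-injectiveˡ; ∷-injectiveʳ; ∷ʳ-injectiveˡ; applyUpTo-∷ʳ; length-applyUpTo; length-removeAt′)
open import Data.List.Membership.Propositional using (_∈_; find; lose)
open import Data.List.Membership.Propositional.Properties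
  using (∈-map⁺; ∈-map⁻; ∈-concatMap⁺; ∈-concatMap⁻; ∈-filter⁺; ∈-filter⁻; ∈-deduplicate⁺; ∈-deduplicate⁻)
open import Data.List.Membership.DecPropositional using () renaming (_∈?_ to mem?)
open import Data.List.Relation.Unary.Any using (here; there; _─_)
open import Data.List.Relation.Unary.All as All using (All)
import Data.List.Relation.Unary.All.Properties as AllP
open import Data.List.Relation.Unary.AllPairs as AllPairs using ()
open import Data.List.Relation.Unary.Unique.Propositional using (Unique)
import Data.List.Relation.Unary.Unique.Propositional.Properties as UniqueP
open import Data.List.Relation.Unary.Unique.DecPropositional.Properties using (deduplicate-!)
open import Data.List.Relation.Binary.Subset.Propositional using (_⊆_)
open import Data.List.Relation.Binary.Disjoint.Propositional using (Disjoint)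
open import Data.List.Relation.Binary.Permutation.Propositional using (_↭_; ↭-refl; ↭-trans; ↭-prep; ↭-swap)
open import Data.List.Relation.Binary.Permutation.Propositional.Properties using (↭-length; ∷↭∷ʳ)
open import Relation.Binary.PropositionalEquality using (refl; sym; trans; cong; cong₂; subst; module ≡-Reasoning)

open ≡-Reasoning

∈-─ : {A : Set} {x y : A} {K : List A} (x∈K : x ∈ K) → y ∈ K → x ≢ y → y ∈ (K ─ x∈K)
∈-─ (here refl) (here refl) x≢y = ⊥-elim (x≢y refl)
∈-─ (here refl) (there y∈K) _   = y∈K
∈-─ (there _)   (here refl) _   = here refl
∈-─ (there x∈K) (there y∈K) x≢y = there (∈-─ x∈K y∈K x≢y)

-- A duplicate-free list contained in K is no longer than K: match its head
-- with an occurrence in K, delete that occurrence and recurse.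
unique-⊆-length : {A : Set} {L K : List A} → Unique L → L ⊆ K → length L ≤ length K
unique-⊆-length {L = []}    _               _   = z≤n
unique-⊆-length {L = x ∷ L} {K} (x∉L AllPairs.∷ L-unique) L⊆K =
  ≤-trans (s≤s (unique-⊆-length L-unique L⊆K─x))
          (≤-reflexive (sym (length-removeAt′ K _)))
  where
    x∈K : x ∈ K
    x∈K = L⊆K (here refl)
    L⊆K─x : L ⊆ (K ─ x∈K)
    L⊆K─x y∈L = ∈-─ x∈K (L⊆K (there y∈L)) (All.lookup x∉L y∈L)

extensions : List Bool → List (List Bool)
extensions c = (true ∷ c) ∷ (false ∷ c) ∷ []

patterns-length : ∀ n {b} → b ∈ patterns n → length b ≡ n
patterns-length zero    (here refl) = refl
patterns-length (suc n) b∈ with find (∈-concatMap⁻ extensions {xs = patterns n} b∈)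
... | c , c∈ , here refl         = cong suc (patterns-length n c∈)
... | c , c∈ , there (here refl) = cong suc (patterns-length n c∈)

patterns-complete : ∀ {n} b → length b ≡ n → b ∈ patterns n
patterns-complete []      refl = here refl
patterns-complete (x ∷ b) refl =
  ∈-concatMap⁺ extensions (lose (patterns-complete b refl) (x∷b∈extensions x))
  where
    x∷b∈extensions : ∀ x → (x ∷ b) ∈ extensions b
    x∷b∈extensions true  = here refl
    x∷b∈extensions false = there (here refl)

length-concatMap-extensions : ∀ cs → length (concatMap extensions cs) ≡ 2 * length cs
length-concatMap-extensions []       = refl
length-concatMap-extensions (c ∷ cs) =
  trans (cong (2 +_) (length-concatMap-extensions cs)) (sym (*-suc 2 (length cs)))

length-patterns : ∀ n → length (patterns n) ≡ 2 ^ n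
length-patterns zero    = refl
length-patterns (suc n) =
  trans (length-concatMap-extensions (patterns n)) (cong (2 *_) (length-patterns n))

∈-Sout⁺ : ∀ {π} b → length b ≡ length π → mtdrl π b ∈ SoutList π
∈-Sout⁺ {π} b lb = ∈-map⁺ (mtdrl π) (patterns-complete b lb)

∈-Sout⁻ : ∀ {π σ} → σ ∈ SoutList π → ∃ λ b → length b ≡ length π × σ ≡ mtdrl π b
∈-Sout⁻ {π} σ∈ with b , b∈ , σ≡ ← ∈-map⁻ (mtdrl π) σ∈ = b , patterns-length _ b∈ , σ≡

length-∷ʳ : ∀ {A : Set} (xs : List A) x → length (xs ∷ʳ x) ≡ suc (length xs)
length-∷ʳ xs x = trans (length-++ xs) (+-comm (length xs) 1)

pick-++ : ∀ xs ys c ds → length xs ≡ length c → pick (xs ++ ys) (c ++ ds) ≡ pick xs c ++ pick ys ds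
pick-++ []       ys []          ds _ = refl
pick-++ (x ∷ xs) ys (true ∷ c)  ds e = cong (x ∷_) (pick-++ xs ys c ds (suc-injective e))
pick-++ (x ∷ xs) ys (false ∷ c) ds e = pick-++ xs ys c ds (suc-injective e)

pickNot-++ : ∀ xs ys c ds → length xs ≡ length c →
  pickNot (xs ++ ys) (c ++ ds) ≡ pickNot xs c ++ pickNot ys ds
pickNot-++ []       ys []          ds _ = refl
pickNot-++ (x ∷ xs) ys (false ∷ c) ds e = cong (x ∷_) (pickNot-++ xs ys c ds (suc-injective e))
pickNot-++ (x ∷ xs) ys (true ∷ c)  ds e = pickNot-++ xs ys c ds (suc-injective e)

middle : Seq → ℕ → List Bool → Seq
middle xs a c = pick xs c ++ a ∷ reverse (pickNot xs c)

mtdrl-∷ʳ : ∀ xs a c x → length xs ≡ length c → mtdrl (xs ∷ʳ a) (c ∷ʳ x) ≡ middle xs a c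
mtdrl-∷ʳ xs a c true e = begin
  pick (xs ∷ʳ a) (c ∷ʳ true) ++ reverse (pickNot (xs ∷ʳ a) (c ∷ʳ true))
    ≡⟨ cong₂ (λ l r → l ++ reverse r) (pick-++ xs [ a ] c [ true ] e) (pickNot-++ xs [ a ] c [ true ] e) ⟩
  (pick xs c ∷ʳ a) ++ reverse (pickNot xs c ++ [])
    ≡⟨ cong (λ r → (pick xs c ∷ʳ a) ++ reverse r) (++-identityʳ (pickNot xs c)) ⟩
  (pick xs c ∷ʳ a) ++ reverse (pickNot xs c)
    ≡⟨ ++-assoc (pick xs c) [ a ] (reverse (pickNot xs c)) ⟩
  middle xs a c ∎
mtdrl-∷ʳ xs a c false e = begin
  pick (xs ∷ʳ a) (c ∷ʳ false) ++ reverse (pickNot (xs ∷ʳ a) (c ∷ʳ false))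
    ≡⟨ cong₂ (λ l r → l ++ reverse r) (pick-++ xs [ a ] c [ false ] e) (pickNot-++ xs [ a ] c [ false ] e) ⟩
  (pick xs c ++ []) ++ reverse (pickNot xs c ∷ʳ a)
    ≡⟨ cong₂ _++_ (++-identityʳ (pick xs c)) (reverse-++ (pickNot xs c) [ a ]) ⟩
  middle xs a c ∎

middles : Seq → ℕ → List Seq
middles xs a = map (middle xs a) (patterns (length xs))

Sout-⊆-middles : ∀ xs a → SoutList (xs ∷ʳ a) ⊆ middles xs a
Sout-⊆-middles xs a σ∈ with b , lb , refl ← ∈-Sout⁻ {xs ∷ʳ a} σ∈ with initLast b
... | [] with () ← trans lb (length-∷ʳ xs a)
... | c ∷ʳ′ x =
  subst (_∈ middles xs a) (sym (mtdrl-∷ʳ xs a c x lxs≡lc)) (∈-map⁺ (middle xs a) (patterns-complete c (sym lxs≡lc)))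
  where
    lxs≡lc : length xs ≡ length c
    lxs≡lc = suc-injective (trans (sym (length-∷ʳ xs a)) (trans (sym lb) (length-∷ʳ c x)))

interList : Seq → Seq → List Seq
interList π ρ = deduplicate seq≟ (filter (λ σ → mem? seq≟ σ (SoutList ρ)) (SoutList π))

∈-interList⁺ : ∀ {π ρ σ} → σ ∈ SoutList π → σ ∈ SoutList ρ → σ ∈ interList π ρ
∈-interList⁺ {ρ = ρ} σ∈π σ∈ρ = ∈-deduplicate⁺ seq≟ (∈-filter⁺ (λ σ → mem? seq≟ σ (SoutList ρ)) σ∈π σ∈ρ)

∈-interList⁻ : ∀ {π ρ σ} → σ ∈ interList π ρ → σ ∈ SoutList π
∈-interList⁻ {π} {ρ} σ∈ =
  proj₁ (∈-filter⁻ (λ σ → mem? seq≟ σ (SoutList ρ)) {xs = SoutList π} (∈-deduplicate⁻ seq≟ _ σ∈))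

interSize-upper : ∀ {k} π ρ → length π ≡ suc k → interSize π ρ ≤ 2 ^ k
interSize-upper π ρ lπ with initLast π
... | [] with () ← lπ
... | xs ∷ʳ′ a rewrite sym (suc-injective (trans (sym (length-∷ʳ xs a)) lπ)) =
  ≤-trans (unique-⊆-length (deduplicate-! seq≟ _) (λ σ∈ → Sout-⊆-middles xs a (∈-interList⁻ {xs ∷ʳ a} {ρ} σ∈)))
          (≤-reflexive (trans (length-map (middle xs a) (patterns (length xs))) (length-patterns (length xs))))

mtdrl-∷-false : ∀ x π b → mtdrl (x ∷ π) (false ∷ b) ≡ mtdrl π b ∷ʳ x
mtdrl-∷-false x π b = begin
  pick π b ++ reverse (x ∷ pickNot π b)   ≡⟨ cong (pick π b ++_) (unfold-reverse x (pickNot π b)) ⟩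
  pick π b ++ (reverse (pickNot π b) ∷ʳ x) ≡⟨ sym (++-assoc (pick π b) (reverse (pickNot π b)) [ x ]) ⟩
  mtdrl π b ∷ʳ x                          ∎

Sout-∷ : ∀ x π {σ} → σ ∈ SoutList π → (x ∷ σ) ∈ SoutList (x ∷ π) × (σ ∷ʳ x) ∈ SoutList (x ∷ π)
Sout-∷ x π σ∈ with b , lb , refl ← ∈-Sout⁻ {π} σ∈ =
  ∈-Sout⁺ (true ∷ b) (cong suc lb) ,
  subst (_∈ SoutList (x ∷ π)) (mtdrl-∷-false x π b) (∈-Sout⁺ (false ∷ b) (cong suc lb))

Common : Seq → Seq → Seq → Set
Common π ρ σ = σ ∈ SoutList π × σ ∈ SoutList ρ

grow : ℕ → List Seq → List Seq
grow x L = map (x ∷_) L ++ map (_∷ʳ x) L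

grow-common : ∀ x π ρ {L} → All (Common π ρ) L → All (Common (x ∷ π) (x ∷ ρ)) (grow x L)
grow-common x π ρ common =
  AllP.++⁺ (AllP.map⁺ (All.map (λ (σ∈π , σ∈ρ) → proj₁ (Sout-∷ x π σ∈π) , proj₁ (Sout-∷ x ρ σ∈ρ)) common))
           (AllP.map⁺ (All.map (λ (σ∈π , σ∈ρ) → proj₂ (Sout-∷ x π σ∈π) , proj₂ (Sout-∷ x ρ σ∈ρ)) common))

length-grow : ∀ x L → length (grow x L) ≡ 2 * length L
length-grow x L = begin
  length (map (x ∷_) L ++ map (_∷ʳ x) L)     ≡⟨ length-++ (map (x ∷_) L) ⟩
  length (map (x ∷_) L) + length (map (_∷ʳ x) L) ≡⟨ cong₂ _+_ (length-map (x ∷_) L) (length-map (_∷ʳ x) L) ⟩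
  length L + length L                         ≡⟨ cong (length L +_) (sym (+-identityʳ (length L))) ⟩
  2 * length L                                ∎

HeadBelow : ℕ → Seq → Set
HeadBelow x []      = ⊥
HeadBelow x (y ∷ _) = y < x

∷≢∷ʳ : ∀ {x} s t → HeadBelow x t → x ∷ s ≢ t ∷ʳ x
∷≢∷ʳ s (y ∷ t) y<x x∷s≡ = <-irrefl (sym (∷-injectiveˡ x∷s≡)) y<x

grow-unique : ∀ x {L} → Unique L → All (HeadBelow x) L → Unique (grow x L)
grow-unique x {L} L-unique heads =
  UniqueP.++⁺ (UniqueP.map⁺ ∷-injectiveʳ L-unique) (UniqueP.map⁺ (∷ʳ-injectiveˡ _ _) L-unique) halves-disjoint
  where
    halves-disjoint : Disjoint (map (x ∷_) L) (map (_∷ʳ x) L)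
    halves-disjoint (p , q) with s , _ , refl ← ∈-map⁻ (x ∷_) p | t , t∈L , x∷s≡ ← ∈-map⁻ (_∷ʳ x) q =
      ∷≢∷ʳ s t (All.lookup heads t∈L) x∷s≡

grow-heads : ∀ {x y L} → x < y → All (HeadBelow x) L → All (HeadBelow y) (grow x L)
grow-heads {x} {y} x<y heads =
  AllP.++⁺ (AllP.map⁺ (All.map (λ _ → x<y) heads)) (AllP.map⁺ (All.map (λ {σ} → append σ) heads))
  where
    append : ∀ σ → HeadBelow x σ → HeadBelow y (σ ∷ʳ x)
    append (z ∷ σ) z<x = <-≤-trans z<x (<⇒≤ x<y)

withTop : ℕ → Seq → Seq
withTop zero    s = s
withTop (suc m) s = (3 + m) ∷ withTop m s

commonFamily : ℕ → List Seq
commonFamily zero    = (1 ∷ 2 ∷ []) ∷ (2 ∷ 1 ∷ []) ∷ []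
commonFamily (suc m) = grow (3 + m) (commonFamily m)

commonFamily-common : ∀ m → All (Common (withTop m (1 ∷ 2 ∷ [])) (withTop m (2 ∷ 1 ∷ []))) (commonFamily m)
commonFamily-common zero    = (here refl , there (here refl)) All.∷ (there (here refl) , here refl) All.∷ All.[]
commonFamily-common (suc m) = grow-common (3 + m) _ _ (commonFamily-common m)

commonFamily-heads : ∀ m → All (HeadBelow (3 + m)) (commonFamily m)
commonFamily-heads zero    = s≤s (s≤s z≤n) All.∷ s≤s (s≤s (s≤s z≤n)) All.∷ All.[]
commonFamily-heads (suc m) = grow-heads (n<1+n (3 + m)) (commonFamily-heads m)

commonFamily-unique : ∀ m → Unique (commonFamily m)
commonFamily-unique zero    = ((λ ()) All.∷ All.[]) AllPairs.∷ All.[] AllPairs.∷ AllPairs.[]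
commonFamily-unique (suc m) = grow-unique (3 + m) (commonFamily-unique m) (commonFamily-heads m)

length-commonFamily : ∀ m → length (commonFamily m) ≡ 2 ^ suc m
length-commonFamily zero    = refl
length-commonFamily (suc m) =
  trans (length-grow (3 + m) (commonFamily m)) (cong (2 *_) (length-commonFamily m))

interSize-lower : ∀ m → 2 ^ suc m ≤ interSize (withTop m (1 ∷ 2 ∷ [])) (withTop m (2 ∷ 1 ∷ []))
interSize-lower m =
  subst (_≤ interSize π ρ) (length-commonFamily m)
    (unique-⊆-length (commonFamily-unique m)
      (λ σ∈ → let (σ∈π , σ∈ρ) = All.lookup (commonFamily-common m) σ∈ in ∈-interList⁺ {π} {ρ} σ∈π σ∈ρ))
  where
    π ρ : Seq
    π = withTop m (1 ∷ 2 ∷ [])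
    ρ = withTop m (2 ∷ 1 ∷ [])

IsPerm-∷ : ∀ {n s} → IsPerm n s → IsPerm (suc n) (suc n ∷ s)
IsPerm-∷ {n} s↭ =
  ↭-trans (↭-prep (suc n) s↭)
    (↭-trans (∷↭∷ʳ (suc n) (oneTo n)) (subst (oneTo n ∷ʳ suc n ↭_) (applyUpTo-∷ʳ suc n) ↭-refl))

withTop-perm : ∀ m {s} → IsPerm 2 s → IsPerm (2 + m) (withTop m s)
withTop-perm zero    s↭ = s↭
withTop-perm (suc m) s↭ = IsPerm-∷ (withTop-perm m s↭)

withTop-injective : ∀ m {s t} → withTop m s ≡ withTop m t → s ≡ t
withTop-injective zero    e = e
withTop-injective (suc m) e = withTop-injective m (∷-injectiveʳ e)

IsPerm-length : ∀ {n π} → IsPerm n π → length π ≡ n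
IsPerm-length {n} π↭ = trans (↭-length π↭) (length-applyUpTo suc n)

theorem8 : (n : ℕ) → 2 ≤ n →
    ((π ρ : Seq) → IsPerm n π → IsPerm n ρ → π ≢ ρ → interSize π ρ ≤ 2 ^ (n ∸ 1))
    × Σ Seq (λ π → Σ Seq (λ ρ →
    IsPerm n π × IsPerm n ρ × π ≢ ρ × interSize π ρ ≡ 2 ^ (n ∸ 1)))
theorem8 (suc (suc m)) (s≤s (s≤s _)) =
  (λ π ρ π-perm _ _ → interSize-upper π ρ (IsPerm-length π-perm)) ,
  (π , ρ , π-perm , ρ-perm , π≢ρ ,
   ≤-antisym (interSize-upper π ρ (IsPerm-length π-perm)) (interSize-lower m))
  where
    π ρ : Seq
    π = withTop m (1 ∷ 2 ∷ [])
    ρ = withTop m (2 ∷ 1 ∷ [])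
    π-perm : IsPerm (2 + m) π
    π-perm = withTop-perm m ↭-refl
    ρ-perm : IsPerm (2 + m) ρ
    ρ-perm = withTop-perm m (↭-swap 2 1 ↭-refl)
    π≢ρ : π ≢ ρ
    π≢ρ e with () ← withTop-injective m e
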